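{- Let $P>2$ be an integer with $4\nmid P$. Suppose \[ \frac4P=\frac1A+\frac1B+\frac1C \] with positive integers $A\le B\le C$. Then $P<4A<3P$. -}

module Defs where

{-# OPTIONS --safe #-}
-- Clearing denominators gives 4ABC = P(BC + AC + AB).  Dropping the positive
-- terms AC + AB yields P < 4A; bounding AC and AB by BC yields 4A ≤ 3P, and
-- 4A = 3P is impossible because 4 is coprime to 3 and does not divide P.
module Submission where

open import Defs
open import Data.Nat using (ℕ; _≤_; _<_; _*_; NonZero)
open import Data.Nat.Divisibility using (_∣_)
open import Data.Integer using (+_)
open import Data.Rational using (ℚ; _/_; _+_)
open import Relation.Binary.PropositionalEquality using (_≡_)
open import Relation.Nullary using (¬_)
open import Data.Product using (_×_)

open import Data.Nat using (suc; >-nonZero⁻¹)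
import Data.Nat as ℕ
open import Data.Nat.Properties
  using (*-cancelʳ-<; *-cancelʳ-≤; *-monoʳ-≤; *-monoˡ-≤; *-mono-≤; +-mono-≤; +-monoʳ-≤; *-monoʳ-<;
         m<m+n; m≤m+n; <-≤-trans; m*n≢0; ≤∧≢⇒<; module ≤-Reasoning)
open import Data.Nat.Divisibility using (m∣m*n)
open import Data.Nat.Coprimality using (Coprime; coprime-divisor; coprime-+; 1-coprimeTo)
open import Data.Nat.Tactic.RingSolver using (solve-∀)
open import Data.Integer.Properties using (+-injective; pos-*)
open import Data.Rational using (toℚᵘ)
open import Data.Rational.Properties using (toℚᵘ-fromℚᵘ; toℚᵘ-cong; toℚᵘ-homo-+)
import Data.Rational.Unnormalised as ℚᵘ
open import Data.Rational.Unnormalised.Properties using (≃-trans; ≃-sym; +-cong)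
open import Relation.Binary.PropositionalEquality using (sym; trans; subst; _≢_; module ≡-Reasoning)
open import Data.Product using (_,_)

toℚᵘ-/ : ∀ n d .{{_ : NonZero d}} → toℚᵘ (n / d) ℚᵘ.≃ n ℚᵘ./ d
toℚᵘ-/ n (suc d) = toℚᵘ-fromℚᵘ (ℚᵘ.mkℚᵘ n d)

toℚᵘ-sum-of-three-unit-fractions : ∀ a b c .{{_ : NonZero a}} .{{_ : NonZero b}} .{{_ : NonZero c}} →
  toℚᵘ (((+ 1) / a + (+ 1) / b) + (+ 1) / c) ℚᵘ.≃ ((+ 1) ℚᵘ./ a ℚᵘ.+ (+ 1) ℚᵘ./ b) ℚᵘ.+ (+ 1) ℚᵘ./ c
toℚᵘ-sum-of-three-unit-fractions a b c =
  ≃-trans (toℚᵘ-homo-+ ((+ 1) / a + (+ 1) / b) ((+ 1) / c))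
    (+-cong (≃-trans (toℚᵘ-homo-+ ((+ 1) / a) ((+ 1) / b)) (+-cong (toℚᵘ-/ (+ 1) a) (toℚᵘ-/ (+ 1) b)))
            (toℚᵘ-/ (+ 1) c))

-- m / d = 1/a + 1/b + 1/c multiplied through by d·a·b·c.
SumOfThreeUnitFractions : (m d a b c : ℕ) → Set
SumOfThreeUnitFractions m d a b c = m * a * (b * c) ≡ d * (b * c ℕ.+ a * c ℕ.+ a * b)

/≡unit-fraction-sum⇒SumOfThreeUnitFractions :
  ∀ m d a b c .{{_ : NonZero d}} .{{_ : NonZero a}} .{{_ : NonZero b}} .{{_ : NonZero c}} →
  (+ m) / d ≡ ((+ 1) / a + (+ 1) / b) + (+ 1) / c → SumOfThreeUnitFractions m d a b c
/≡unit-fraction-sum⇒SumOfThreeUnitFractions m d@(suc _) a@(suc _) b@(suc _) c@(suc _) eq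
  with ≃-trans (≃-sym (toℚᵘ-/ (+ m) d)) (≃-trans (toℚᵘ-cong eq) (toℚᵘ-sum-of-three-unit-fractions a b c))
... | ℚᵘ.*≡* e = begin
  m * a * (b * c)                                 ≡⟨ *-assoc-right m a b c ⟩
  m * (a * b * c)                                 ≡⟨ +-injective (trans (pos-* m (a * b * c)) e) ⟩
  ((1 * b ℕ.+ 1 * a) * c ℕ.+ 1 * (a * b)) * d     ≡⟨ rearrange a b c d ⟩
  d * (b * c ℕ.+ a * c ℕ.+ a * b)                 ∎
  where
  open ≡-Reasoning
  *-assoc-right : ∀ m a b c → m * a * (b * c) ≡ m * (a * b * c)
  *-assoc-right = solve-∀
  rearrange : ∀ a b c d → ((1 * b ℕ.+ 1 * a) * c ℕ.+ 1 * (a * b)) * d ≡ d * (b * c ℕ.+ a * c ℕ.+ a * b)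
  rearrange = solve-∀

SumOfThreeUnitFractions⇒d<m*a : ∀ m d a b c .{{_ : NonZero d}} .{{_ : NonZero a}} .{{_ : NonZero c}} →
  SumOfThreeUnitFractions m d a b c → d < m * a
SumOfThreeUnitFractions⇒d<m*a m d a b c sum = *-cancelʳ-< (b * c) d (m * a) (begin-strict
  d * (b * c)                       <⟨ *-monoʳ-< d (<-≤-trans (m<m+n (b * c) (>-nonZero⁻¹ (a * c) {{m*n≢0 a c}}))
                                                              (m≤m+n (b * c ℕ.+ a * c) (a * b))) ⟩
  d * (b * c ℕ.+ a * c ℕ.+ a * b)   ≡⟨ sym sum ⟩
  m * a * (b * c)                   ∎)
  where open ≤-Reasoning

SumOfThreeUnitFractions⇒m*a≤3*d : ∀ m d a b c .{{_ : NonZero b}} .{{_ : NonZero c}} → a ≤ b → b ≤ c →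
  SumOfThreeUnitFractions m d a b c → m * a ≤ 3 * d
SumOfThreeUnitFractions⇒m*a≤3*d m d a b c a≤b b≤c sum = *-cancelʳ-≤ (m * a) (3 * d) (b * c) {{m*n≢0 b c}} (begin
  m * a * (b * c)                   ≡⟨ sum ⟩
  d * (b * c ℕ.+ a * c ℕ.+ a * b)   ≤⟨ *-monoʳ-≤ d (+-mono-≤ (+-monoʳ-≤ (b * c) (*-monoˡ-≤ c a≤b)) (*-mono-≤ a≤b b≤c)) ⟩
  d * (b * c ℕ.+ b * c ℕ.+ b * c)   ≡⟨ triple d (b * c) ⟩
  3 * d * (b * c)                   ∎)
  where
  open ≤-Reasoning
  triple : ∀ d x → d * (x ℕ.+ x ℕ.+ x) ≡ 3 * d * x
  triple = solve-∀

lemma3p1 : (P A B C : ℕ) → .{{_ : NonZero P}} → .{{_ : NonZero A}} → .{{_ : NonZero B}} → .{{_ : NonZero C}}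
    → 2 < P → ¬ (4 ∣ P) → A ≤ B → B ≤ C
    → (+ 4) / P ≡ ((+ 1) / A + (+ 1) / B) + (+ 1) / C
    → (P < 4 * A) × (4 * A < 3 * P)
lemma3p1 P A B C _ 4∤P A≤B B≤C eq =
  SumOfThreeUnitFractions⇒d<m*a 4 P A B C sum ,
  ≤∧≢⇒< (SumOfThreeUnitFractions⇒m*a≤3*d 4 P A B C A≤B B≤C sum) 4A≢3P
  where
  sum : SumOfThreeUnitFractions 4 P A B C
  sum = /≡unit-fraction-sum⇒SumOfThreeUnitFractions 4 P A B C eq
  coprime[4,3] : Coprime 4 3
  coprime[4,3] = coprime-+ (1-coprimeTo 3)
  4A≢3P : 4 * A ≢ 3 * P
  4A≢3P 4A≡3P = 4∤P (coprime-divisor coprime[4,3] (subst (4 ∣_) 4A≡3P (m∣m*n A)))
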